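{- Let $G$ be a connected skew graph with table $T$. Then $G$ is pathwise tough if and only if all of the following hold: (i) for every row $R$ of $T$, $|G|\ge 2|V(R)|-1$; (ii) for every column $C$ of $T$, $|G|\ge 2|V(C)|-1$; (iii) for every row $R$ and column $C$ of $T$ with $V(R)\not\subseteq V(C)$ and $V(C)\not\subseteq V(R)$, $|G|\ge |V(R)|+|V(C)|$.
   Context: A skew graph is defined from a table $T$ of boxes with $m$ rows and $n$ columns, the box $(i,j)$ containing a non-negative integer $t_{ij}$: the graph has, for each box $(i,j)$, exactly $t_{ij}$ vertices located in that box, and two vertices are adjacent if and only if their boxes lie in different rows and in different columns. For a row $R$ (column $C$), $V(R)$ (resp. $V(C)$) is the set of vertices located in the boxes of $R$ (resp. $C$). $|G|$ denotes the number of vertices of $G$. A graph $G$ is pathwise tough if $c(G\setminus S)\le |S|+1$ for every $S\subseteq V(G)$, where $c(\cdot)$ is the number of connected components. -}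

module Defs where

open import Data.Nat using (ℕ; _+_; _*_; _∸_; _≤_)
open import Data.Fin using (Fin; _≟_)
open import Data.Bool using (Bool; true; false; not; _∧_)
open import Data.List using (List; length; concatMap; map; allFin; filterᵇ)
open import Data.Product using (Σ; Σ-syntax; ∃; _×_; _,_; proj₁; proj₂)
open import Relation.Nullary using (¬_; ⌊_⌋)
open import Relation.Binary.PropositionalEquality using (_≡_; _≢_)
open import Function.Bundles using (_⇔_)

Table : ℕ → ℕ → Set
Table m n = Fin m → Fin n → ℕ

module Skew {m n : ℕ} (T : Table m n) where

  -- a vertex is (row, column, index among the T i j vertices of the box)
  Vertex : Set
  Vertex = Σ[ i ∈ Fin m ] Σ[ j ∈ Fin n ] Fin (T i j)

  row : Vertex → Fin m
  row v = proj₁ v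

  col : Vertex → Fin n
  col v = proj₁ (proj₂ v)

  Adj : Vertex → Vertex → Set
  Adj u v = (row u ≢ row v) × (col u ≢ col v)

  allVertices : List Vertex
  allVertices = concatMap (λ i → concatMap (λ j → map (λ k → (i , j , k)) (allFin (T i j))) (allFin n)) (allFin m)

  VSet : Set
  VSet = Vertex → Bool

  ∣_∣ : VSet → ℕ
  ∣ S ∣ = length (filterᵇ S allVertices)

  order : ℕ
  order = length allVertices

  V-row : Fin m → VSet
  V-row i v = ⌊ row v ≟ i ⌋

  V-col : Fin n → VSet
  V-col j v = ⌊ col v ≟ j ⌋

  _⊆_ : VSet → VSet → Set
  A ⊆ B = ∀ v → A v ≡ true → B v ≡ true

  ∅ : VSet
  ∅ _ = false

  Remaining : VSet → Set
  Remaining S = Σ[ v ∈ Vertex ] S v ≡ false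

  data Reach (S : VSet) : Vertex → Vertex → Set where
    here : ∀ {u} → S u ≡ false → Reach S u u
    step : ∀ {u v w} → S u ≡ false → Adj u v → Reach S v w → Reach S u w

  -- c(G \ S) = k : the connected components of G \ S are in bijection
  -- with Fin k (a surjective labelling identifying exactly connected vertices)
  NumComponents : VSet → ℕ → Set
  NumComponents S k =
    Σ[ f ∈ (Remaining S → Fin k) ]
      ((∀ c → ∃ λ x → f x ≡ c) ×
       (∀ x y → (f x ≡ f y) ⇔ Reach S (proj₁ x) (proj₁ y)))

  Connected : Set
  Connected = ∀ u v → Reach ∅ u v

  PathwiseTough : Set
  PathwiseTough = ∀ (S : VSet) (k : ℕ) → NumComponents S k → k ≤ ∣ S ∣ + 1

  Cond-i : Set
  Cond-i = ∀ (R : Fin m) → 2 * ∣ V-row R ∣ ∸ 1 ≤ order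

  Cond-ii : Set
  Cond-ii = ∀ (C : Fin n) → 2 * ∣ V-col C ∣ ∸ 1 ≤ order

  Cond-iii : Set
  Cond-iii = ∀ (R : Fin m) (C : Fin n) →
    ¬ (V-row R ⊆ V-col C) → ¬ (V-col C ⊆ V-row R) →
    ∣ V-row R ∣ + ∣ V-col C ∣ ≤ order

-- Necessity: deleting everything outside a row R leaves the independent set V(R), i.e. |V(R)|
-- components, which gives (i) and likewise (ii); when neither of R and C contains the other,
-- deleting everything outside V(R) ∪ V(C) leaves the vertices of the box R ∩ C isolated and joins
-- all others into a single component, which gives (iii).
-- Sufficiency: two components force S ≠ ∅ by connectivity. Representatives of three components are
-- pairwise non-adjacent, hence lie on a common line L. If G \ S lies inside L, the components
-- inject into V(L) and (i) or (ii) applies. Otherwise a vertex w of G \ S off L, together with two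
-- representatives in other components, confines G \ S to L and the line L' through w crossing L;
-- then either G \ S lies inside L', or all its components but one lie in the box L ∩ L', whose
-- size (iii) bounds by |S|.

module Submission where

open import Defs
open import Axiom.UniquenessOfIdentityProofs using (module Decidable⇒UIP)
open import Data.Bool using (Bool; true; false; not; _∧_; _∨_; T?)
import Data.Bool as Bool
open import Data.Bool.Properties using (T-≡; T-not-≡; ¬-not; not-¬; not-injective)
open import Data.Empty using (⊥-elim)
open import Data.Fin using (Fin; zero; suc; _≟_; punchIn)
open import Data.Fin.Properties
  using (injective⇒≤; punchIn-injective; punchInᵢ≢i; suc-injective; 0≢1+n)
open import Data.List using (List; []; _∷_; length; filterᵇ; lookup; map; concatMap; allFin)
open import Data.List.Membership.Propositional using (_∈_)
open import Data.List.Membership.Propositional.Properties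
  using (∈-lookup; ∈-map⁺; ∈-concat⁺′; ∈-allFin; ∈-filter⁺; ∈-filter⁻)
open import Data.List.Relation.Unary.All using (All)
import Data.List.Relation.Unary.All as All
import Data.List.Relation.Unary.All.Properties as All
open import Data.List.Relation.Unary.AllPairs using (_∷_)
import Data.List.Relation.Unary.AllPairs as AllPairs
import Data.List.Relation.Unary.AllPairs.Properties as AllPairs
open import Data.List.Relation.Unary.Any using (here; there; any?; satisfied)
import Data.List.Relation.Unary.Any as Any
open import Data.List.Relation.Unary.Any.Properties using (lookup-index)
open import Data.List.Relation.Unary.Unique.Propositional using (Unique)
open import Data.List.Relation.Binary.Disjoint.Propositional using (Disjoint)
import Data.List.Relation.Unary.Unique.Propositional.Properties as Unique
open import Data.Nat using (ℕ; zero; suc; _+_; _*_; _∸_; _≤_; z≤n; s≤s)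
open import Data.Nat.Properties using (≤-trans; ≤-reflexive; ≤-pred; m≤n⇒m≤1+n; m≤n+m;
  +-comm; +-suc; +-identityʳ; +-monoʳ-≤; +-monoˡ-≤; +-cancelˡ-≤; module ≤-Reasoning)
open import Data.Product using (∃; _×_; _,_; proj₁; proj₂; swap)
open import Data.Sum using (_⊎_; inj₁; inj₂; [_,_])
open import Function using (_∘_; id)
open import Function.Bundles using (_⇔_; mk⇔; Equivalence)
open import Relation.Nullary using (¬_; yes; no; ⌊_⌋)
open import Relation.Nullary.Decidable using (_×-dec_; toWitness; fromWitness; toWitnessFalse)
open import Relation.Binary.PropositionalEquality using (_≡_; _≢_; refl; sym; trans; cong; subst)

module _ {A : Set} where

  length-filterᵇ-not : (P : A → Bool) (xs : List A) →
    length (filterᵇ P xs) + length (filterᵇ (not ∘ P) xs) ≡ length xs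
  length-filterᵇ-not P [] = refl
  length-filterᵇ-not P (x ∷ xs) with P x
  ... | true  = cong suc (length-filterᵇ-not P xs)
  ... | false = trans (+-suc _ _) (cong suc (length-filterᵇ-not P xs))

  length-filterᵇ-mono : (P Q : A → Bool) → (∀ x → P x ≡ true → Q x ≡ true) → ∀ xs →
    length (filterᵇ P xs) ≤ length (filterᵇ Q xs)
  length-filterᵇ-mono P Q P⊆Q [] = z≤n
  length-filterᵇ-mono P Q P⊆Q (x ∷ xs) with P x in px | Q x in qx
  ... | true  | true  = s≤s (length-filterᵇ-mono P Q P⊆Q xs)
  ... | true  | false with () ← trans (sym (P⊆Q x px)) qx
  ... | false | true  = m≤n⇒m≤1+n (length-filterᵇ-mono P Q P⊆Q xs)
  ... | false | false = length-filterᵇ-mono P Q P⊆Q xs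

  length-filterᵇ-∨-∧ : (P Q : A → Bool) (xs : List A) →
    length (filterᵇ P xs) + length (filterᵇ Q xs) ≡
    length (filterᵇ (λ x → P x ∨ Q x) xs) + length (filterᵇ (λ x → P x ∧ Q x) xs)
  length-filterᵇ-∨-∧ P Q [] = refl
  length-filterᵇ-∨-∧ P Q (x ∷ xs) with P x | Q x
  ... | true  | true  =
    cong suc (trans (+-suc _ _) (trans (cong suc (length-filterᵇ-∨-∧ P Q xs)) (sym (+-suc _ _))))
  ... | true  | false = cong suc (length-filterᵇ-∨-∧ P Q xs)
  ... | false | true  = trans (+-suc _ _) (cong suc (length-filterᵇ-∨-∧ P Q xs))
  ... | false | false = length-filterᵇ-∨-∧ P Q xs

  length-filterᵇ≡0⇒reject : (P : A → Bool) (xs : List A) → length (filterᵇ P xs) ≡ 0 →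
    ∀ {x} → x ∈ xs → P x ≡ false
  length-filterᵇ≡0⇒reject P (y ∷ xs) empty x∈ with P y in py
  length-filterᵇ≡0⇒reject P (y ∷ xs) empty (here refl) | false = py
  length-filterᵇ≡0⇒reject P (y ∷ xs) empty (there x∈) | false =
    length-filterᵇ≡0⇒reject P xs empty x∈

  lookup-injective : {xs : List A} → Unique xs → ∀ i j → lookup xs i ≡ lookup xs j → i ≡ j
  lookup-injective {_ ∷ _} _ zero zero _ = refl
  lookup-injective {_ ∷ _} (x∉ ∷ _) zero (suc j) eq = ⊥-elim (All.lookup x∉ (∈-lookup j) eq)
  lookup-injective {_ ∷ _} (x∉ ∷ _) (suc i) zero eq = ⊥-elim (All.lookup x∉ (∈-lookup i) (sym eq))
  lookup-injective {_ ∷ _} (_ ∷ u) (suc i) (suc j) eq = cong suc (lookup-injective u i j eq)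

2*a∸1≤a+b⇔a≤b+1 : ∀ a b → 2 * a ∸ 1 ≤ a + b ⇔ a ≤ b + 1
2*a∸1≤a+b⇔a≤b+1 zero    b = mk⇔ (λ _ → z≤n) (λ _ → z≤n)
2*a∸1≤a+b⇔a≤b+1 (suc a) b = mk⇔
  (λ le → ≤-trans (s≤s (+-cancelˡ-≤ (suc a) a b (subst (_≤ suc a + b) double le)))
                  (≤-reflexive (+-comm 1 b)))
  (λ le → subst (_≤ suc a + b) (sym double)
            (+-monoʳ-≤ (suc a) (≤-pred (subst (suc a ≤_) (+-comm b 1) le))))
  where
  double : 2 * suc a ∸ 1 ≡ suc a + a
  double = trans (+-suc a (a + 0)) (cong (λ z → suc (a + z)) (+-identityʳ a))

module _ {I A : Set} (h : A → I) where

  separated⇒disjoint : {a b : I} {xs ys : List A} →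
    All (λ x → h x ≡ a) xs → All (λ y → h y ≡ b) ys → a ≢ b → Disjoint xs ys
  separated⇒disjoint hx hy a≢b (x∈ , y∈) = a≢b (trans (sym (All.lookup hx x∈)) (All.lookup hy y∈))

  concatMap-unique : (f : I → List A) → (∀ i → Unique (f i)) → (∀ i → All (λ x → h x ≡ i) (f i)) →
    ∀ {is} → Unique is → Unique (concatMap f is)
  concatMap-unique f f-unique f-fibre is-unique = Unique.concat⁺
    (All.map⁺ (All.universal f-unique _))
    (AllPairs.map⁺ (AllPairs.map (separated⇒disjoint (f-fibre _) (f-fibre _)) is-unique))

module _ {c : ℕ} {x y : Fin c} where

  ⌊≟⌋-true⁻ : ⌊ x ≟ y ⌋ ≡ true → x ≡ y
  ⌊≟⌋-true⁻ = toWitness ∘ Equivalence.from T-≡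

  ⌊≟⌋-true⁺ : x ≡ y → ⌊ x ≟ y ⌋ ≡ true
  ⌊≟⌋-true⁺ = Equivalence.to T-≡ ∘ fromWitness

  ⌊≟⌋-false⁻ : ⌊ x ≟ y ⌋ ≡ false → x ≢ y
  ⌊≟⌋-false⁻ = toWitnessFalse ∘ Equivalence.from T-not-≡

module Counting {m n : ℕ} (T : Table m n) where
  open Skew T

  boxVertices : Fin m → Fin n → List Vertex
  boxVertices i j = map (λ k → (i , j , k)) (allFin (T i j))

  rowVertices : Fin m → List Vertex
  rowVertices i = concatMap (boxVertices i) (allFin n)

  ∈-allVertices : ∀ v → v ∈ allVertices
  ∈-allVertices (i , j , k) =
    ∈-concat⁺′ (∈-concat⁺′ (∈-map⁺ (λ k → (i , j , k)) (∈-allFin k))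
                           (∈-map⁺ (boxVertices i) (∈-allFin j)))
               (∈-map⁺ rowVertices (∈-allFin i))

  allVertices-unique : Unique allVertices
  allVertices-unique =
    concatMap-unique row rowVertices rowVertices-unique rowVertices-row (Unique.allFin⁺ m)
    where
    onBox : ∀ {P : Vertex → Set} i j → (∀ k → P (i , j , k)) → All P (boxVertices i j)
    onBox i j p = All.map⁺ (All.universal p _)

    rowVertices-unique : ∀ i → Unique (rowVertices i)
    rowVertices-unique i = concatMap-unique col (boxVertices i)
      (λ j → Unique.map⁺ (λ { refl → refl }) (Unique.allFin⁺ (T i j)))
      (λ j → onBox i j (λ _ → refl)) (Unique.allFin⁺ n)

    rowVertices-row : ∀ i → All (λ v → row v ≡ i) (rowVertices i)
    rowVertices-row i =
      All.concat⁺ (All.map⁺ (All.universal (λ j → onBox i j (λ _ → refl)) (allFin n)))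

  members : VSet → List Vertex
  members P = filterᵇ P allVertices

  ∈-members : (P : VSet) {x : Vertex} → P x ≡ true → x ∈ members P
  ∈-members P px = ∈-filter⁺ (T? ∘ P) (∈-allVertices _) (Equivalence.from T-≡ px)

  position : (P : VSet) {x : Vertex} → P x ≡ true → Fin ∣ P ∣
  position P px = Any.index (∈-members P px)

  member : (P : VSet) → Fin ∣ P ∣ → Vertex
  member P = lookup (members P)

  member-∈ : (P : VSet) (i : Fin ∣ P ∣) → P (member P i) ≡ true
  member-∈ P i = Equivalence.to T-≡ (proj₂ (∈-filter⁻ (T? ∘ P) {xs = allVertices} (∈-lookup i)))

  member-position : (P : VSet) {x : Vertex} (px : P x ≡ true) → member P (position P px) ≡ x
  member-position P px = sym (lookup-index (∈-members P px))

  position-member : (P : VSet) (i : Fin ∣ P ∣) (px : P (member P i) ≡ true) → position P px ≡ i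
  position-member P i px =
    lookup-injective (Unique.filter⁺ (T? ∘ P) allVertices-unique) _ _ (member-position P px)

  position-injective : (P : VSet) {x y : Vertex} (px : P x ≡ true) (py : P y ≡ true) →
    position P px ≡ position P py → x ≡ y
  position-injective P px py eq =
    trans (sym (member-position P px)) (trans (cong (member P) eq) (member-position P py))

  ∣∣-injection : {a : ℕ} (P : VSet) (g : Fin a → Vertex) → (∀ {i j} → g i ≡ g j → i ≡ j) →
    (∀ i → P (g i) ≡ true) → a ≤ ∣ P ∣
  ∣∣-injection P g g-injective g∈P =
    injective⇒≤ (g-injective ∘ position-injective P (g∈P _) (g∈P _))

  ∣∣-not : (P : VSet) → ∣ P ∣ + ∣ not ∘ P ∣ ≡ order
  ∣∣-not P = length-filterᵇ-not P allVertices

  ∣∣-mono : (P Q : VSet) → P ⊆ Q → ∣ P ∣ ≤ ∣ Q ∣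
  ∣∣-mono P Q P⊆Q = length-filterᵇ-mono P Q P⊆Q allVertices

  ∣∣-∨-∧ : (P Q : VSet) → ∣ P ∣ + ∣ Q ∣ ≡ ∣ (λ v → P v ∨ Q v) ∣ + ∣ (λ v → P v ∧ Q v) ∣
  ∣∣-∨-∧ P Q = length-filterᵇ-∨-∧ P Q allVertices

  ∣∣≡0⇒∅ : (P : VSet) → ∣ P ∣ ≡ 0 → ∀ v → P v ≡ false
  ∣∣≡0⇒∅ P empty v = length-filterᵇ≡0⇒reject P allVertices empty (∈-allVertices v)

  covered-or-escape : (S B : VSet) →
    (∀ (x : Remaining S) → B (proj₁ x) ≡ true) ⊎ (∃ λ (x : Remaining S) → B (proj₁ x) ≡ false)
  covered-or-escape S B with any? (λ v → (S v Bool.≟ false) ×-dec (B v Bool.≟ false)) allVertices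
  ... | yes found = let v , sv , bv = satisfied found in inj₂ ((v , sv) , bv)
  ... | no none   =
    inj₁ λ (v , sv) → ¬-not (λ bv → none (Any.map (λ { refl → sv , bv }) (∈-allVertices v)))

  ⊈⇒witness : (A B : VSet) → ¬ (A ⊆ B) → ∃ λ v → A v ≡ true × B v ≡ false
  ⊈⇒witness A B A⊈B with covered-or-escape (not ∘ A) B
  ... | inj₁ covered           = ⊥-elim (A⊈B (λ v av → covered (v , cong not av)))
  ... | inj₂ ((v , av) , bv) = v , not-injective av , bv

  position₀ : (P : VSet) {x : Vertex} {b : Bool} → P x ≡ b → Fin (suc ∣ P ∣)
  position₀ P {b = true}  px = suc (position P px)
  position₀ P {b = false} _  = zero

  position₀-refl : (P : VSet) {x : Vertex} {b : Bool} (px : P x ≡ b) →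
    position₀ P {x} refl ≡ position₀ P px
  position₀-refl P refl = refl

module Components {m n : ℕ} (T : Table m n) where
  open Skew T
  open Counting T

  Adj-sym : ∀ {u v} → Adj u v → Adj v u
  Adj-sym (rows≢ , cols≢) = rows≢ ∘ sym , cols≢ ∘ sym

  ¬Adj⇒same-row⊎col : ∀ u v → ¬ Adj u v → row u ≡ row v ⊎ col u ≡ col v
  ¬Adj⇒same-row⊎col u v ¬adj with row u ≟ row v | col u ≟ col v
  ... | yes rows≡ | _         = inj₁ rows≡
  ... | no _      | yes cols≡ = inj₂ cols≡
  ... | no rows≢  | no cols≢  = ⊥-elim (¬adj (rows≢ , cols≢))

  pairwise-¬Adj⇒collinear : ∀ x y z → ¬ Adj x y → ¬ Adj x z → ¬ Adj y z →
    (row x ≡ row y × row x ≡ row z) ⊎ (col x ≡ col y × col x ≡ col z)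
  pairwise-¬Adj⇒collinear x y z ¬xy ¬xz ¬yz
    with ¬Adj⇒same-row⊎col x y ¬xy | ¬Adj⇒same-row⊎col x z ¬xz | ¬Adj⇒same-row⊎col y z ¬yz
  ... | inj₁ rxy | inj₁ rxz | _        = inj₁ (rxy , rxz)
  ... | inj₁ rxy | inj₂ _   | inj₁ ryz = inj₁ (rxy , trans rxy ryz)
  ... | inj₁ _   | inj₂ cxz | inj₂ cyz = inj₂ (trans cxz (sym cyz) , cxz)
  ... | inj₂ cxy | inj₂ cxz | _        = inj₂ (cxy , cxz)
  ... | inj₂ cxy | inj₁ _   | inj₂ cyz = inj₂ (cxy , trans cxy cyz)
  ... | inj₂ _   | inj₁ rxz | inj₁ ryz = inj₁ (trans rxz (sym ryz) , rxz)

  remaining-≡ : {S : VSet} {x y : Remaining S} → proj₁ x ≡ proj₁ y → x ≡ y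
  remaining-≡ {x = v , sx} {.v , sy} refl = cong (v ,_) (Decidable⇒UIP.≡-irrelevant Bool._≟_ sx sy)

  reach-source : ∀ {S u v} → Reach S u v → S u ≡ false
  reach-source (here su)     = su
  reach-source (step su _ _) = su

  Reach-∅ : ∀ {S u v} → (∀ w → S w ≡ false) → Reach ∅ u v → Reach S u v
  Reach-∅ S≡∅ (here _)       = here (S≡∅ _)
  Reach-∅ S≡∅ (step _ adj r) = step (S≡∅ _) adj (Reach-∅ S≡∅ r)

  numComponents : (S : VSet) {k : ℕ} (ℓ : Remaining S → Fin k) → (∀ c → ∃ λ x → ℓ x ≡ c) →
    (∀ x y → Adj (proj₁ x) (proj₁ y) → ℓ x ≡ ℓ y) →
    (∀ x y → ℓ x ≡ ℓ y → Reach S (proj₁ x) (proj₁ y)) →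
    NumComponents S k
  numComponents S ℓ surjective edge-invariant separating =
    ℓ , surjective , λ x y → mk⇔ (separating x y) (reach⇒≡ x y)
    where
    reach⇒≡ : ∀ x y → Reach S (proj₁ x) (proj₁ y) → ℓ x ≡ ℓ y
    reach⇒≡ x y (here _) = cong ℓ (remaining-≡ refl)
    reach⇒≡ x y (step {v = v} _ adj walk) =
      trans (edge-invariant x (v , reach-source walk) adj) (reach⇒≡ (v , reach-source walk) y walk)

  Independent : VSet → Set
  Independent A = ∀ u v → A u ≡ true → A v ≡ true → ¬ Adj u v

  independent-components : (A : VSet) → Independent A → NumComponents (not ∘ A) ∣ A ∣
  independent-components A independent = numComponents (not ∘ A) ℓ surjective
    (λ (u , su) (v , sv) adj → ⊥-elim (independent u v (not-injective su) (not-injective sv) adj))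
    (λ (u , su) (v , sv) eq → subst (Reach (not ∘ A) u)
      (position-injective A (not-injective su) (not-injective sv) eq) (here su))
    where
    ℓ : Remaining (not ∘ A) → Fin ∣ A ∣
    ℓ (v , sv) = position A (not-injective sv)

    surjective : ∀ c → ∃ λ x → ℓ x ≡ c
    surjective c = (member A c , cong not (member-∈ A c)) , position-member A c _

  module Labelling {S : VSet} {k : ℕ} (nc : NumComponents S (suc k)) where

    label : Remaining S → Fin (suc k)
    label = proj₁ nc

    rep : Fin (suc k) → Remaining S
    rep c = proj₁ (proj₁ (proj₂ nc) c)

    label-rep : ∀ c → label (rep c) ≡ c
    label-rep c = proj₂ (proj₁ (proj₂ nc) c)

    rep-separated : ∀ {c d} → label (rep c) ≡ label (rep d) → c ≡ d
    rep-separated {c} {d} eq = trans (sym (label-rep c)) (trans eq (label-rep d))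

    rep-label≢ : ∀ {c d} → c ≢ d → label (rep c) ≢ label (rep d)
    rep-label≢ c≢d = c≢d ∘ rep-separated

    rep-injective : ∀ {c d} → proj₁ (rep c) ≡ proj₁ (rep d) → c ≡ d
    rep-injective = rep-separated ∘ cong label ∘ remaining-≡

    reach⇒label≡ : ∀ x y → Reach S (proj₁ x) (proj₁ y) → label x ≡ label y
    reach⇒label≡ x y = Equivalence.from (proj₂ (proj₂ nc) x y)

    adj⇒label≡ : ∀ x y → Adj (proj₁ x) (proj₁ y) → label x ≡ label y
    adj⇒label≡ x y adj = reach⇒label≡ x y (step (proj₂ x) adj (here (proj₂ y)))

    components≤ : (B : VSet) → (∀ x → B (proj₁ x) ≡ true) → suc k ≤ ∣ B ∣
    components≤ B covered = ∣∣-injection B (proj₁ ∘ rep) rep-injective (covered ∘ rep)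

    components-outside≤ : (B : VSet) (c₀ : Fin (suc k)) →
      (∀ x → label x ≢ c₀ → B (proj₁ x) ≡ true) → k ≤ ∣ B ∣
    components-outside≤ B c₀ covered = ∣∣-injection B (proj₁ ∘ rep ∘ punchIn c₀)
      (punchIn-injective c₀ _ _ ∘ rep-injective)
      (λ c → covered (rep (punchIn c₀ c)) (punchInᵢ≢i c₀ c ∘ trans (sym (label-rep _))))

    covered⇒tough : (B : VSet) → (∀ x → B (proj₁ x) ≡ true) → 2 * ∣ B ∣ ∸ 1 ≤ order →
      suc k ≤ ∣ S ∣ + 1
    covered⇒tough B covered balanced = ≤-trans (components≤ B covered)
      (Equivalence.to (2*a∸1≤a+b⇔a≤b+1 ∣ B ∣ ∣ S ∣) (begin
        2 * ∣ B ∣ ∸ 1        ≤⟨ balanced ⟩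
        order                ≡⟨ sym (∣∣-not S) ⟩
        ∣ S ∣ + ∣ not ∘ S ∣   ≤⟨ +-monoʳ-≤ ∣ S ∣ (∣∣-mono (not ∘ S) B kept⊆B) ⟩
        ∣ S ∣ + ∣ B ∣         ≡⟨ +-comm ∣ S ∣ ∣ B ∣ ⟩
        ∣ B ∣ + ∣ S ∣         ∎))
      where
      open ≤-Reasoning
      kept⊆B : (not ∘ S) ⊆ B
      kept⊆B v sv = covered (v , not-injective sv)

    rep-¬adj : ∀ {c d} → c ≢ d → ¬ Adj (proj₁ (rep c)) (proj₁ (rep d))
    rep-¬adj c≢d = rep-label≢ c≢d ∘ adj⇒label≡ _ _

    connected⇒1≤∣S∣ : Connected → ∀ c d → c ≢ d → 1 ≤ ∣ S ∣
    connected⇒1≤∣S∣ connected c d c≢d with ∣ S ∣ in size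
    ... | suc _ = s≤s z≤n
    ... | zero  = ⊥-elim (c≢d (rep-separated
      (reach⇒label≡ (rep c) (rep d) (Reach-∅ (∣∣≡0⇒∅ S size) (connected _ _)))))

-- p and q play the roles of row and column; instantiating them the other way round transposes
-- the table, so each argument below serves for rows and for columns alike.
module Lines {m n : ℕ} (T : Table m n) {a b : ℕ}
    (p : Skew.Vertex T → Fin a) (q : Skew.Vertex T → Fin b)
    (adj⇔ : ∀ {u v} → Skew.Adj T u v ⇔ (p u ≢ p v × q u ≢ q v)) where
  open Skew T
  open Counting T
  open Components T

  P-line : Fin a → VSet
  P-line R v = ⌊ p v ≟ R ⌋

  Q-line : Fin b → VSet
  Q-line C v = ⌊ q v ≟ C ⌋

  Balanced : {c : ℕ} → (Fin c → VSet) → Set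
  Balanced line = ∀ L → 2 * ∣ line L ∣ ∸ 1 ≤ order

  Crossing : Set
  Crossing = ∀ R C → ¬ (P-line R ⊆ Q-line C) → ¬ (Q-line C ⊆ P-line R) →
    ∣ P-line R ∣ + ∣ Q-line C ∣ ≤ order

  Cross : Fin a → Fin b → VSet
  Cross R C v = P-line R v ∨ Q-line C v

  Box : Fin a → Fin b → VSet
  Box R C v = P-line R v ∧ Q-line C v

  ¬Adj⇒q≡ : ∀ {u v} → ¬ Adj u v → p u ≢ p v → q u ≡ q v
  ¬Adj⇒q≡ {u} {v} ¬adj p≢ with q u ≟ q v
  ... | yes q≡ = q≡
  ... | no  q≢ = ⊥-elim (¬adj (Equivalence.from adj⇔ (p≢ , q≢)))

  P-line-independent : ∀ R → Independent (P-line R)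
  P-line-independent R u v u∈ v∈ adj =
    proj₁ (Equivalence.to adj⇔ adj) (trans (⌊≟⌋-true⁻ u∈) (sym (⌊≟⌋-true⁻ v∈)))

  balanced-necessary : PathwiseTough → Balanced P-line
  balanced-necessary tough R = subst (2 * ∣ P-line R ∣ ∸ 1 ≤_) (∣∣-not (P-line R))
    (Equivalence.from (2*a∸1≤a+b⇔a≤b+1 _ _)
      (tough (not ∘ P-line R) _ (independent-components (P-line R) (P-line-independent R))))

  Box-true⁺ : ∀ {R C v} → p v ≡ R → q v ≡ C → Box R C v ≡ true
  Box-true⁺ {R} {C} {v} pR qC with p v ≟ R | q v ≟ C
  ... | yes _ | yes _ = refl
  ... | no p≢ | _     = ⊥-elim (p≢ pR)
  ... | yes _ | no q≢ = ⊥-elim (q≢ qC)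

  Box-true⁻ : ∀ {R C v} → Box R C v ≡ true → p v ≡ R × q v ≡ C
  Box-true⁻ {R} {C} {v} e with p v ≟ R | q v ≟ C
  ... | yes pR | yes qC = pR , qC

  Box-false⁺ : ∀ {R C v} → p v ≢ R ⊎ q v ≢ C → Box R C v ≡ false
  Box-false⁺ {R} {C} {v} off with p v ≟ R | q v ≟ C
  ... | yes pR | yes qC = ⊥-elim ([ (λ p≢ → p≢ pR) , (λ q≢ → q≢ qC) ] off)
  ... | yes _  | no _   = refl
  ... | no _   | _      = refl

  Cross-true⁻ : ∀ {R C v} → Cross R C v ≡ true → p v ≡ R ⊎ q v ≡ C
  Cross-true⁻ {R} {C} {v} e with p v ≟ R | q v ≟ C
  ... | yes pR | _      = inj₁ pR
  ... | no _   | yes qC = inj₂ qC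

  Cross-true⁺ : ∀ {R C v} → p v ≡ R ⊎ q v ≡ C → Cross R C v ≡ true
  Cross-true⁺ {R} {C} {v} on with p v ≟ R | q v ≟ C
  ... | yes _  | _      = refl
  ... | no _   | yes _  = refl
  ... | no p≢  | no q≢  = ⊥-elim ([ p≢ , q≢ ] on)

  data Place (R : Fin a) (C : Fin b) (v : Vertex) : Set where
    on-both  : p v ≡ R → q v ≡ C → Place R C v
    P-only   : p v ≡ R → q v ≢ C → Place R C v
    Q-only   : p v ≢ R → q v ≡ C → Place R C v
    off-both : p v ≢ R → q v ≢ C → Place R C v

  place : ∀ R C v → Place R C v
  place R C v with p v ≟ R | q v ≟ C
  ... | yes pR | yes qC = on-both pR qC
  ... | yes pR | no  q≢ = P-only pR q≢
  ... | no  p≢ | yes qC = Q-only p≢ qC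
  ... | no  p≢ | no  q≢ = off-both p≢ q≢

  P-only-Q-only-adj : ∀ {R C u v} → p u ≡ R → q u ≢ C → p v ≢ R → q v ≡ C → Adj u v
  P-only-Q-only-adj pu qu pv qv =
    Equivalence.from adj⇔ ((λ pu≡pv → pv (trans (sym pu≡pv) pu)) , (λ qu≡qv → qu (trans qu≡qv qv)))

  off-both-on-both-adj : ∀ {R C u v} → p u ≢ R → q u ≢ C → p v ≡ R → q v ≡ C → Adj u v
  off-both-on-both-adj pu qu pv qv =
    Equivalence.from adj⇔ ((λ pu≡pv → pu (trans pu≡pv pv)) , (λ qu≡qv → qu (trans qu≡qv qv)))

  on-both-isolated : ∀ {R C u v} → p u ≡ R → q u ≡ C → p v ≡ R ⊎ q v ≡ C → ¬ Adj u v
  on-both-isolated pu qu on adj with Equivalence.to adj⇔ adj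
  ... | p≢ , q≢ = [ (λ pv → p≢ (trans pu (sym pv))) , (λ qv → q≢ (trans qu (sym qv))) ] on

  -- Every vertex of R \ C is adjacent to every vertex of C \ R, so together they form a single
  -- component, while the vertices of R ∩ C have no neighbours left.
  module CrossComponents {R : Fin a} {C : Fin b} {x₀ y₀ : Vertex}
      (x₀′ : p x₀ ≡ R × q x₀ ≢ C) (y₀′ : p y₀ ≢ R × q y₀ ≡ C) where

    S₀ : VSet
    S₀ = not ∘ Cross R C

    kept⇒on-line : (x : Remaining S₀) → p (proj₁ x) ≡ R ⊎ q (proj₁ x) ≡ C
    kept⇒on-line (_ , sv) = Cross-true⁻ (not-injective sv)

    on-line⇒kept : ∀ {v} → p v ≡ R ⊎ q v ≡ C → S₀ v ≡ false
    on-line⇒kept = cong not ∘ Cross-true⁺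

    ℓ : Remaining S₀ → Fin (suc ∣ Box R C ∣)
    ℓ (v , _) = position₀ (Box R C) {v} refl

    ℓ-off-box : (x : Remaining S₀) → p (proj₁ x) ≢ R ⊎ q (proj₁ x) ≢ C → ℓ x ≡ zero
    ℓ-off-box x off = position₀-refl (Box R C) (Box-false⁺ off)

    adj⇒off-box : (x y : Remaining S₀) → Adj (proj₁ x) (proj₁ y) → p (proj₁ x) ≢ R ⊎ q (proj₁ x) ≢ C
    adj⇒off-box x y adj with place R C (proj₁ x)
    ... | on-both pR qC = ⊥-elim (on-both-isolated pR qC (kept⇒on-line y) adj)
    ... | P-only _ q≢   = inj₂ q≢
    ... | Q-only p≢ _   = inj₁ p≢
    ... | off-both p≢ _ = inj₁ p≢

    RimP RimQ Rim : Vertex → Set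
    RimP v = p v ≡ R × q v ≢ C
    RimQ v = p v ≢ R × q v ≡ C
    Rim v = RimP v ⊎ RimQ v

    rim-kept : ∀ {v} → Rim v → S₀ v ≡ false
    rim-kept (inj₁ (pR , _)) = on-line⇒kept (inj₁ pR)
    rim-kept (inj₂ (_ , qC)) = on-line⇒kept (inj₂ qC)

    across : ∀ {u v} → RimP u → RimQ v → Adj u v
    across (pu , qu) (pv , qv) = P-only-Q-only-adj pu qu pv qv

    across′ : ∀ {u v} → RimQ u → RimP v → Adj u v
    across′ {u} {v} u′ v′ = Adj-sym {v} {u} (across v′ u′)

    edge : ∀ {u v} → Rim u → Rim v → Adj u v → Reach S₀ u v
    edge ru rv adj = step (rim-kept ru) adj (here (rim-kept rv))

    rim-connected : ∀ {u v} → Rim u → Rim v → Reach S₀ u v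
    rim-connected (inj₁ u′) (inj₂ v′) = edge (inj₁ u′) (inj₂ v′) (across u′ v′)
    rim-connected (inj₂ u′) (inj₁ v′) = edge (inj₂ u′) (inj₁ v′) (across′ u′ v′)
    rim-connected (inj₁ u′) (inj₁ v′) =
      step (rim-kept (inj₁ u′)) (across u′ y₀′) (edge (inj₂ y₀′) (inj₁ v′) (across′ y₀′ v′))
    rim-connected (inj₂ u′) (inj₂ v′) =
      step (rim-kept (inj₂ u′)) (across′ u′ x₀′) (edge (inj₁ x₀′) (inj₂ v′) (across x₀′ v′))

    kind : (x : Remaining S₀) → (p (proj₁ x) ≡ R × q (proj₁ x) ≡ C) ⊎ Rim (proj₁ x)
    kind x with place R C (proj₁ x)
    ... | on-both pR qC   = inj₁ (pR , qC)
    ... | P-only pR q≢    = inj₂ (inj₁ (pR , q≢))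
    ... | Q-only p≢ qC    = inj₂ (inj₂ (p≢ , qC))
    ... | off-both p≢ q≢  = ⊥-elim ([ p≢ , q≢ ] (kept⇒on-line x))

    ℓ-box : (x : Remaining S₀) (pR : p (proj₁ x) ≡ R) (qC : q (proj₁ x) ≡ C) →
      ℓ x ≡ suc (position (Box R C) (Box-true⁺ pR qC))
    ℓ-box x pR qC = position₀-refl (Box R C) (Box-true⁺ pR qC)

    ℓ-rim : (x : Remaining S₀) → Rim (proj₁ x) → ℓ x ≡ zero
    ℓ-rim x (inj₁ (_ , q≢)) = ℓ-off-box x (inj₂ q≢)
    ℓ-rim x (inj₂ (p≢ , _)) = ℓ-off-box x (inj₁ p≢)

    ℓ-box-rim-apart : (x y : Remaining S₀) → p (proj₁ x) ≡ R → q (proj₁ x) ≡ C → Rim (proj₁ y) →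
      ℓ x ≢ ℓ y
    ℓ-box-rim-apart x y pR qC rim-y eq =
      0≢1+n (trans (sym (ℓ-rim y rim-y)) (trans (sym eq) (ℓ-box x pR qC)))

    ℓ-edge : (x y : Remaining S₀) → Adj (proj₁ x) (proj₁ y) → ℓ x ≡ ℓ y
    ℓ-edge x y adj = trans (ℓ-off-box x (adj⇒off-box x y adj))
      (sym (ℓ-off-box y (adj⇒off-box y x (Adj-sym {proj₁ x} {proj₁ y} adj))))

    separating : (x y : Remaining S₀) → ℓ x ≡ ℓ y → Reach S₀ (proj₁ x) (proj₁ y)
    separating x y eq with kind x | kind y
    ... | inj₁ (px , qx) | inj₁ (py , qy) =
      subst (Reach S₀ (proj₁ x)) (position-injective (Box R C) _ _
        (suc-injective (trans (sym (ℓ-box x px qx)) (trans eq (ℓ-box y py qy))))) (here (proj₂ x))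
    ... | inj₁ (px , qx) | inj₂ rim-y    = ⊥-elim (ℓ-box-rim-apart x y px qx rim-y eq)
    ... | inj₂ rim-x    | inj₁ (py , qy) = ⊥-elim (ℓ-box-rim-apart y x py qy rim-x (sym eq))
    ... | inj₂ rim-x    | inj₂ rim-y    = rim-connected rim-x rim-y

    surjective : ∀ c → ∃ λ x → ℓ x ≡ c
    surjective zero    = (x₀ , rim-kept (inj₁ x₀′)) , ℓ-rim (x₀ , rim-kept (inj₁ x₀′)) (inj₁ x₀′)
    surjective (suc c) with Box-true⁻ (member-∈ (Box R C) c)
    ... | pR , qC = x , trans (ℓ-box x pR qC) (cong suc (position-member (Box R C) c _))
      where
      x : Remaining S₀
      x = member (Box R C) c , on-line⇒kept (inj₁ pR)

    components : NumComponents S₀ (suc ∣ Box R C ∣)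
    components = numComponents S₀ ℓ surjective ℓ-edge separating

  crossing-necessary : PathwiseTough → Crossing
  crossing-necessary tough R C R⊈C C⊈R
    with ⊈⇒witness (P-line R) (Q-line C) R⊈C | ⊈⇒witness (Q-line C) (P-line R) C⊈R
  ... | x₀ , x₀∈R , x₀∉C | y₀ , y₀∈C , y₀∉R = begin
      ∣ P-line R ∣ + ∣ Q-line C ∣          ≡⟨ ∣∣-∨-∧ (P-line R) (Q-line C) ⟩
      ∣ Cross R C ∣ + ∣ Box R C ∣          ≤⟨ +-monoʳ-≤ ∣ Cross R C ∣ box≤S₀ ⟩
      ∣ Cross R C ∣ + ∣ not ∘ Cross R C ∣  ≡⟨ ∣∣-not (Cross R C) ⟩
      order                                ∎
    where
    open ≤-Reasoning
    open CrossComponents (⌊≟⌋-true⁻ x₀∈R , ⌊≟⌋-false⁻ x₀∉C) (⌊≟⌋-false⁻ y₀∉R , ⌊≟⌋-true⁻ y₀∈C)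

    box≤S₀ : ∣ Box R C ∣ ≤ ∣ S₀ ∣
    box≤S₀ = ≤-pred (subst (suc ∣ Box R C ∣ ≤_) (+-comm ∣ S₀ ∣ 1) (tough S₀ _ components))

  module Sufficiency {S : VSet} {k : ℕ} (nc : NumComponents S (suc k))
      (P-balanced : Balanced P-line) (Q-balanced : Balanced Q-line) (crossing : Crossing) where
    open Labelling nc

    cross-covered⇒Box≤S : ∀ {R C} → ¬ (P-line R ⊆ Q-line C) → ¬ (Q-line C ⊆ P-line R) →
      (∀ (x : Remaining S) → p (proj₁ x) ≡ R ⊎ q (proj₁ x) ≡ C) → ∣ Box R C ∣ ≤ ∣ S ∣
    cross-covered⇒Box≤S {R} {C} R⊈C C⊈R covered = +-cancelˡ-≤ ∣ Cross R C ∣ _ _ (begin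
      ∣ Cross R C ∣ + ∣ Box R C ∣          ≡⟨ sym (∣∣-∨-∧ (P-line R) (Q-line C)) ⟩
      ∣ P-line R ∣ + ∣ Q-line C ∣          ≤⟨ crossing R C R⊈C C⊈R ⟩
      order                                ≡⟨ sym (∣∣-not (Cross R C)) ⟩
      ∣ Cross R C ∣ + ∣ not ∘ Cross R C ∣  ≤⟨ +-monoʳ-≤ ∣ Cross R C ∣ (∣∣-mono _ S outside⊆S) ⟩
      ∣ Cross R C ∣ + ∣ S ∣                ∎)
      where
      open ≤-Reasoning
      outside⊆S : (not ∘ Cross R C) ⊆ S
      outside⊆S v off = ¬-not λ sv → not-¬ (Cross-true⁺ (covered (v , sv))) (not-injective off)

    -- With u₁, u₂ on R and w off R in three distinct components, every remaining vertex lies on R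
    -- or on the line C through w (otherwise it would join u₁ and u₂). Either all lie on C, or some
    -- a₀ lies in R \ C, and then every component other than that of a₀ lies inside R ∩ C.
    module OffLine (R : Fin a) (w u₁ u₂ : Remaining S)
        (w-off : p (proj₁ w) ≢ R) (u₁-on : p (proj₁ u₁) ≡ R) (u₂-on : p (proj₁ u₂) ≡ R)
        (u₁≢u₂ : label u₁ ≢ label u₂) (w≢u₁ : label w ≢ label u₁) (w≢u₂ : label w ≢ label u₂) where

      C : Fin b
      C = q (proj₁ w)

      separated⇒q≡C : ∀ u → p (proj₁ u) ≡ R → label w ≢ label u → q (proj₁ u) ≡ C
      separated⇒q≡C u u-on w≢u = sym (¬Adj⇒q≡ (w≢u ∘ adj⇒label≡ w u) (λ eq → w-off (trans eq u-on)))

      cross-covered : ∀ (x : Remaining S) → p (proj₁ x) ≡ R ⊎ q (proj₁ x) ≡ C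
      cross-covered x with place R C (proj₁ x)
      ... | on-both pR _   = inj₁ pR
      ... | P-only pR _    = inj₁ pR
      ... | Q-only _ qC    = inj₂ qC
      ... | off-both p≢ q≢ = ⊥-elim (u₁≢u₂ (trans (sym (adj⇒label≡ x u₁ (adj-to u₁ u₁-on w≢u₁)))
                                                  (adj⇒label≡ x u₂ (adj-to u₂ u₂-on w≢u₂))))
        where
        adj-to : ∀ u → p (proj₁ u) ≡ R → label w ≢ label u → Adj (proj₁ x) (proj₁ u)
        adj-to u u-on w≢u = off-both-on-both-adj p≢ q≢ u-on (separated⇒q≡C u u-on w≢u)

      bound : suc k ≤ ∣ S ∣ + 1
      bound with covered-or-escape S (Q-line C)
      ... | inj₁ on-C        = covered⇒tough (Q-line C) on-C (Q-balanced C)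
      ... | inj₂ (a₀ , a₀∉C) = begin
          suc k                ≤⟨ s≤s (components-outside≤ (Box R C) (label a₀) in-box) ⟩
          suc ∣ Box R C ∣      ≤⟨ s≤s (cross-covered⇒Box≤S R⊈C C⊈R cross-covered) ⟩
          suc ∣ S ∣            ≡⟨ +-comm 1 ∣ S ∣ ⟩
          ∣ S ∣ + 1            ∎
        where
        open ≤-Reasoning
        a₀-q : q (proj₁ a₀) ≢ C
        a₀-q = ⌊≟⌋-false⁻ a₀∉C

        a₀-p : p (proj₁ a₀) ≡ R
        a₀-p = [ (λ pR → pR) , (λ qC → ⊥-elim (a₀-q qC)) ] (cross-covered a₀)

        a₀~w : label a₀ ≡ label w
        a₀~w = adj⇒label≡ a₀ w (P-only-Q-only-adj a₀-p a₀-q w-off refl)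

        in-box : ∀ x → label x ≢ label a₀ → Box R C (proj₁ x) ≡ true
        in-box x x≁a₀ with place R C (proj₁ x)
        ... | on-both pR qC  = Box-true⁺ pR qC
        ... | P-only pR q≢   =
          ⊥-elim (x≁a₀ (trans (adj⇒label≡ x w (P-only-Q-only-adj pR q≢ w-off refl)) (sym a₀~w)))
        ... | Q-only p≢ qC   =
          ⊥-elim (x≁a₀ (sym (adj⇒label≡ a₀ x (P-only-Q-only-adj a₀-p a₀-q p≢ qC))))
        ... | off-both p≢ q≢ = ⊥-elim ([ p≢ , q≢ ] (cross-covered x))

        R⊈C : ¬ (P-line R ⊆ Q-line C)
        R⊈C R⊆C = a₀-q (⌊≟⌋-true⁻ (R⊆C _ (⌊≟⌋-true⁺ a₀-p)))

        C⊈R : ¬ (Q-line C ⊆ P-line R)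
        C⊈R C⊆R = w-off (⌊≟⌋-true⁻ (C⊆R _ (⌊≟⌋-true⁺ refl)))

    collinear-bound : ∀ R (x y z : Remaining S) →
      p (proj₁ x) ≡ R → p (proj₁ y) ≡ R → p (proj₁ z) ≡ R →
      label x ≢ label y → label x ≢ label z → label y ≢ label z → suc k ≤ ∣ S ∣ + 1
    collinear-bound R x y z x-on y-on z-on x≢y x≢z y≢z with covered-or-escape S (P-line R)
    ... | inj₁ on-R = covered⇒tough (P-line R) on-R (P-balanced R)
    ... | inj₂ (w , w∉R) with label w ≟ label x | label w ≟ label y
    ...   | yes w≡x | _       = OffLine.bound R w y z (⌊≟⌋-false⁻ w∉R) y-on z-on y≢z
                                  (x≢y ∘ trans (sym w≡x)) (x≢z ∘ trans (sym w≡x))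
    ...   | no w≢x  | yes w≡y = OffLine.bound R w x z (⌊≟⌋-false⁻ w∉R) x-on z-on x≢z
                                  w≢x (y≢z ∘ trans (sym w≡y))
    ...   | no w≢x  | no w≢y  = OffLine.bound R w x y (⌊≟⌋-false⁻ w∉R) x-on y-on x≢y w≢x w≢y

module _ {m n : ℕ} (T : Table m n) where
  open Skew T
  open Components T

  private
    module Rows    = Lines T row col (mk⇔ id id)
    module Columns = Lines T col row (mk⇔ swap swap)

  pathwiseTough-necessary : PathwiseTough → Cond-i × Cond-ii × Cond-iii
  pathwiseTough-necessary tough =
    Rows.balanced-necessary tough , Columns.balanced-necessary tough , Rows.crossing-necessary tough

  module _ (i : Cond-i) (ii : Cond-ii) (iii : Cond-iii) {S : VSet} {k : ℕ}
      (nc : NumComponents S (suc (suc (suc k)))) where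
    open Labelling nc

    private
      transposed-iii : Columns.Crossing
      transposed-iii C R C⊈R R⊈C =
        subst (_≤ order) (+-comm ∣ V-row R ∣ ∣ V-col C ∣) (iii R C R⊈C C⊈R)

      x y z : Remaining S
      x = rep zero
      y = rep (suc zero)
      z = rep (suc (suc zero))

    three-components-bound : suc (suc (suc k)) ≤ ∣ S ∣ + 1
    three-components-bound
      with pairwise-¬Adj⇒collinear (proj₁ x) (proj₁ y) (proj₁ z)
             (rep-¬adj λ ()) (rep-¬adj λ ()) (rep-¬adj λ ())
    ... | inj₁ (xy , xz) = Rows.Sufficiency.collinear-bound nc i ii iii
      _ x y z refl (sym xy) (sym xz) (rep-label≢ λ ()) (rep-label≢ λ ()) (rep-label≢ λ ())
    ... | inj₂ (xy , xz) = Columns.Sufficiency.collinear-bound nc ii i transposed-iii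
      _ x y z refl (sym xy) (sym xz) (rep-label≢ λ ()) (rep-label≢ λ ()) (rep-label≢ λ ())

  pathwiseTough-sufficient : Connected → Cond-i × Cond-ii × Cond-iii → PathwiseTough
  pathwiseTough-sufficient _ _ S zero _ = z≤n
  pathwiseTough-sufficient _ _ S (suc zero) _ = m≤n+m 1 ∣ S ∣
  pathwiseTough-sufficient connected _ S (suc (suc zero)) nc =
    +-monoˡ-≤ 1 (Labelling.connected⇒1≤∣S∣ nc connected zero (suc zero) λ ())
  pathwiseTough-sufficient _ (i , ii , iii) S (suc (suc (suc k))) nc =
    three-components-bound i ii iii nc

theorem8 : ∀ {m n : ℕ} (T : Table m n) → Skew.Connected T →
    Skew.PathwiseTough T ⇔ (Skew.Cond-i T × Skew.Cond-ii T × Skew.Cond-iii T)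
theorem8 T connected = mk⇔ (pathwiseTough-necessary T) (pathwiseTough-sufficient T connected)
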